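{- Let $C_4$ be the cycle on 4 vertices. Then $W[C_4]=W^*[C_4]=4$.
   Context: Graphs are finite, simple, undirected, loopless. First-order sentences about graphs use only adjacency $\sim$ and equality $=$. Write $F\sqsubset G$ if $G$ contains an induced copy of $F$. $W[F]$ is the minimum number of distinct variables in a first-order sentence $\Phi$ with $G\models\Phi$ iff $F\sqsubset G$ for all graphs $G$. For non-isomorphic $G,H$, $W(G,H)$ is the minimum number of distinct variables in a sentence true on one and false on the other; $W^*[F]=\max\{W(G,H):F\sqsubset G,\ F\not\sqsubset H\}$. -}

module Defs where

open import Data.Nat using (ℕ; zero; suc; _<_)
open import Data.Fin using (Fin; zero; suc; _≟_)
open import Data.Bool using (Bool; true; false)
open import Data.Maybe using (Maybe; just; nothing)
open import Data.Product using (Σ; ∃; _×_; _,_)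
open import Data.Sum using (_⊎_)
open import Data.Empty using (⊥)
open import Data.Unit using (⊤)
open import Relation.Nullary using (¬_; yes; no)
open import Relation.Binary.PropositionalEquality using (_≡_; refl)
open import Function.Definitions using (Injective)

record Graph : Set where
  field
    size   : ℕ
    adj    : Fin size → Fin size → Bool
    sym    : ∀ u v → adj u v ≡ adj v u
    irrefl : ∀ v → adj v v ≡ false
open Graph public

_⊏_ : Graph → Graph → Set
F ⊏ G = Σ (Fin (size F) → Fin (size G)) λ f →
          Injective _≡_ _≡_ f × (∀ u v → adj G (f u) (f v) ≡ adj F u v)

c4adj : Fin 4 → Fin 4 → Bool
c4adj zero                   (suc zero)             = true
c4adj zero                   (suc (suc (suc zero))) = true
c4adj (suc zero)             zero                   = true
c4adj (suc zero)             (suc (suc zero))       = true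
c4adj (suc (suc zero))       (suc zero)             = true
c4adj (suc (suc zero))       (suc (suc (suc zero))) = true
c4adj (suc (suc (suc zero))) (suc (suc zero))       = true
c4adj (suc (suc (suc zero))) zero                   = true
c4adj _ _ = false

c4sym : ∀ u v → c4adj u v ≡ c4adj v u
c4sym zero zero = refl
c4sym zero (suc zero) = refl
c4sym zero (suc (suc zero)) = refl
c4sym zero (suc (suc (suc zero))) = refl
c4sym (suc zero) zero = refl
c4sym (suc zero) (suc zero) = refl
c4sym (suc zero) (suc (suc zero)) = refl
c4sym (suc zero) (suc (suc (suc zero))) = refl
c4sym (suc (suc zero)) zero = refl
c4sym (suc (suc zero)) (suc zero) = refl
c4sym (suc (suc zero)) (suc (suc zero)) = refl
c4sym (suc (suc zero)) (suc (suc (suc zero))) = refl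
c4sym (suc (suc (suc zero))) zero = refl
c4sym (suc (suc (suc zero))) (suc zero) = refl
c4sym (suc (suc (suc zero))) (suc (suc zero)) = refl
c4sym (suc (suc (suc zero))) (suc (suc (suc zero))) = refl

c4irrefl : ∀ v → c4adj v v ≡ false
c4irrefl zero = refl
c4irrefl (suc zero) = refl
c4irrefl (suc (suc zero)) = refl
c4irrefl (suc (suc (suc zero))) = refl

C₄ : Graph
C₄ = record { size = 4 ; adj = c4adj ; sym = c4sym ; irrefl = c4irrefl }

-- First-order formulas in the language {∼, =} over the k variables
-- x₀ … x_{k-1} (variables may be re-quantified).  A formula of type
-- Formula k uses at most k distinct variables, and every formula with
-- at most k distinct variables can be renamed into Formula k.

data Formula (k : ℕ) : Set where
  _∼_ _≐_ : Fin k → Fin k → Formula k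
  ¬'_     : Formula k → Formula k
  _∧'_ _∨'_ : Formula k → Formula k → Formula k
  ∃'_·_ ∀'_·_ : Fin k → Formula k → Formula k

update : ∀ {k} {A : Set} → (Fin k → A) → Fin k → A → Fin k → A
update ρ x a y with x ≟ y
... | yes _ = a
... | no  _ = ρ y

Bound : ∀ {k} → (Fin k → Bool) → Fin k → Set
Bound β x = β x ≡ true

WellScoped : ∀ {k} → (Fin k → Bool) → Formula k → Set
WellScoped β (x ∼ y) = Bound β x × Bound β y
WellScoped β (x ≐ y) = Bound β x × Bound β y
WellScoped β (¬' φ) = WellScoped β φ
WellScoped β (φ ∧' ψ) = WellScoped β φ × WellScoped β ψ
WellScoped β (φ ∨' ψ) = WellScoped β φ × WellScoped β ψ
WellScoped β (∃' x · φ) = WellScoped (update β x true) φ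
WellScoped β (∀' x · φ) = WellScoped (update β x true) φ

Sentence : ∀ {k} → Formula k → Set
Sentence φ = WellScoped (λ _ → false) φ

-- Tarski semantics; unassigned variables (never reached in a sentence)
-- make atoms false.
Adj : (G : Graph) → Maybe (Fin (size G)) → Maybe (Fin (size G)) → Set
Adj G (just u) (just v) = adj G u v ≡ true
Adj G _ _ = ⊥

Eq : (G : Graph) → Maybe (Fin (size G)) → Maybe (Fin (size G)) → Set
Eq G (just u) (just v) = u ≡ v
Eq G _ _ = ⊥

Sat : ∀ {k} (G : Graph) → (Fin k → Maybe (Fin (size G))) → Formula k → Set
Sat G ρ (x ∼ y) = Adj G (ρ x) (ρ y)
Sat G ρ (x ≐ y) = Eq G (ρ x) (ρ y)
Sat G ρ (¬' φ) = ¬ Sat G ρ φ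
Sat G ρ (φ ∧' ψ) = Sat G ρ φ × Sat G ρ ψ
Sat G ρ (φ ∨' ψ) = Sat G ρ φ ⊎ Sat G ρ ψ
Sat G ρ (∃' x · φ) = Σ (Fin (size G)) λ v → Sat G (update ρ x (just v)) φ
Sat G ρ (∀' x · φ) = (v : Fin (size G)) → Sat G (update ρ x (just v)) φ

_⊨_ : ∀ {k} → Graph → Formula k → Set
G ⊨ φ = Sat G (λ _ → nothing) φ

Defines : ∀ {k} → Formula k → Graph → Set
Defines φ F = Sentence φ × (∀ G → (G ⊨ φ → F ⊏ G) × (F ⊏ G → G ⊨ φ))

DefinableWith : ℕ → Graph → Set
DefinableWith k F = Σ (Formula k) λ φ → Defines φ F

DistinguishableWith : ℕ → Graph → Graph → Set
DistinguishableWith k G H = Σ (Formula k) λ φ → Sentence φ ×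
  ((G ⊨ φ × ¬ (H ⊨ φ)) ⊎ (H ⊨ φ × ¬ (G ⊨ φ)))

WEq : Graph → ℕ → Set
WEq F k = DefinableWith k F × (∀ j → j < k → ¬ DefinableWith j F)

WPairEq : Graph → Graph → ℕ → Set
WPairEq G H k = DistinguishableWith k G H × (∀ j → j < k → ¬ DistinguishableWith j G H)

-- W*[F] = k : max of W(G,H) over F ⊏ G, F ⋢ H equals k
WStarEq : Graph → ℕ → Set
WStarEq F k =
  (∀ G H → F ⊏ G → ¬ (F ⊏ H) → DistinguishableWith k G H) ×
  (Σ Graph λ G → Σ Graph λ H → F ⊏ G × ¬ (F ⊏ H) × WPairEq G H k)

-- Four variables suffice: "some x₀ x₁ x₂ x₃ span an induced 4-cycle" defines containment
-- of C₄, and a sentence defining it separates any graph containing C₄ from any graph that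
-- does not.  Three do not: the Wagner graph contains C₄ and the Petersen graph does not, yet
-- both are triangle-free and realise every triangle-free adjacency pattern over at most two
-- given vertices.  So Duplicator wins the three-pebble game on them: no sentence with three
-- variables tells them apart, and in particular none defines containment of C₄.

module Submission where

open import Defs
open import Data.Product using (_×_)

open import Data.Nat using (ℕ; suc; _<_; _≡ᵇ_; s≤s)
open import Data.Bool using (Bool; true; false; _∧_; _∨_)
open import Data.Bool.Properties using (⇔→≡; ∧-comm; ∨-comm; ¬-not; not-¬)
  renaming (_≟_ to _≟ᵇ_)
open import Data.Fin using (Fin; toℕ; _≟_)
open import Data.Fin.Patterns using (0F; 1F; 2F; 3F)
open import Data.Fin.Properties using (all?; any?)
open import Data.List using (List; []; _∷_)
open import Data.Maybe using (Maybe; just; nothing)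
open import Data.Product using (∃₂; ∃-syntax; _,_; proj₁; proj₂; map₂)
open import Data.Sum using (_⊎_; inj₁; inj₂; [_,_])
open import Data.Empty using (⊥-elim)
open import Function using (case_of_)
open import Function.Bundles using (_⇔_; mk⇔; Equivalence)
open import Function.Construct.Identity using (⇔-id)
open import Function.Construct.Symmetry using (⇔-sym)
open import Relation.Nullary using (¬_; Dec; yes; no; ¬?)
open import Relation.Nullary.Decidable using (True; toWitness; from-yes; from-no; _×-dec_; _⊎-dec_; _→-dec_)
open import Relation.Binary.PropositionalEquality using (_≡_; _≢_; refl; trans; subst; cong₂)
import Relation.Binary.PropositionalEquality as ≡

open Equivalence using (to; from)

module _ {G : Graph} where

  Eq-sym : ∀ {a b} → Eq G a b → Eq G b a
  Eq-sym {just _} {just _} refl = refl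
  Eq-sym {just _} {nothing} ()
  Eq-sym {nothing} ()

  Adj-sym : ∀ {a b} → Adj G a b → Adj G b a
  Adj-sym {just u} {just v} e = trans (Graph.sym G v u) e
  Adj-sym {just _} {nothing} ()
  Adj-sym {nothing} ()

refuted-⇔ : ∀ {A B : Set} → ¬ A → ¬ B → A ⇔ B
refuted-⇔ ¬a ¬b = mk⇔ (λ a → ⊥-elim (¬a a)) (λ b → ⊥-elim (¬b b))

-- Partial isomorphisms and the pebble game

module _ (G H : Graph) where

  private
    VG = Maybe (Fin (size G))
    VH = Maybe (Fin (size H))

  SameAtoms : VG → VG → VH → VH → Set
  SameAtoms a a′ b b′ = (Eq G a a′ ⇔ Eq H b b′) × (Adj G a a′ ⇔ Adj H b b′)

  PartialIso : ∀ {k} → (Fin k → VG) → (Fin k → VH) → Set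
  PartialIso ρ σ = ∀ x y → SameAtoms (ρ x) (ρ y) (σ x) (σ y)

  Forth : ℕ → Set
  Forth k = ∀ (ρ : Fin k → VG) (σ : Fin k → VH) → PartialIso ρ σ → ∀ x v →
    ∃[ w ] PartialIso (update ρ x (just v)) (update σ x (just w))

  Back : ℕ → Set
  Back k = ∀ (ρ : Fin k → VG) (σ : Fin k → VH) → PartialIso ρ σ → ∀ x w →
    ∃[ v ] PartialIso (update ρ x (just v)) (update σ x (just w))

  sat-⇔ : ∀ {k} → Forth k → Back k → ∀ {ρ σ} → PartialIso ρ σ →
          (φ : Formula k) → Sat G ρ φ ⇔ Sat H σ φ
  sat-⇔ F B R (x ∼ y) = proj₂ (R x y)
  sat-⇔ F B R (x ≐ y) = proj₁ (R x y)
  sat-⇔ F B R (¬' φ) = mk⇔ (λ ¬s t → ¬s (from ih t)) (λ ¬t s → ¬t (to ih s))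
    where ih = sat-⇔ F B R φ
  sat-⇔ F B R (φ ∧' ψ) = mk⇔
    (λ (s , t) → to (sat-⇔ F B R φ) s , to (sat-⇔ F B R ψ) t)
    (λ (s , t) → from (sat-⇔ F B R φ) s , from (sat-⇔ F B R ψ) t)
  sat-⇔ F B R (φ ∨' ψ) = mk⇔
    [ (λ s → inj₁ (to (sat-⇔ F B R φ) s)) , (λ t → inj₂ (to (sat-⇔ F B R ψ) t)) ]
    [ (λ s → inj₁ (from (sat-⇔ F B R φ) s)) , (λ t → inj₂ (from (sat-⇔ F B R ψ) t)) ]
  sat-⇔ F B {ρ} {σ} R (∃' x · φ) = mk⇔
    (λ (v , s) → let (w , R′) = F ρ σ R x v in w , to (sat-⇔ F B R′ φ) s)
    (λ (w , t) → let (v , R′) = B ρ σ R x w in v , from (sat-⇔ F B R′ φ) t)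
  sat-⇔ F B {ρ} {σ} R (∀' x · φ) = mk⇔
    (λ s w → let (v , R′) = B ρ σ R x w in to (sat-⇔ F B R′ φ) (s v))
    (λ t v → let (w , R′) = F ρ σ R x v in from (sat-⇔ F B R′ φ) (t w))

  sameAtoms-flip : ∀ {a a′ b b′} → SameAtoms a a′ b b′ → SameAtoms a′ a b′ b
  sameAtoms-flip (e , d) =
    mk⇔ (λ p → Eq-sym (to e (Eq-sym p))) (λ q → Eq-sym (from e (Eq-sym q))) ,
    mk⇔ (λ p → Adj-sym (to d (Adj-sym p))) (λ q → Adj-sym (from d (Adj-sym q)))

  sameAtoms-just : ∀ {v a w b} → (v ≡ a ⇔ w ≡ b) → adj G v a ≡ adj H w b →
                   SameAtoms (just v) (just a) (just w) (just b)
  sameAtoms-just e d = e , mk⇔ (trans (≡.sym d)) (trans d)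

  sameAtoms-refl : ∀ {v w} → SameAtoms (just v) (just v) (just w) (just w)
  sameAtoms-refl {v} {w} = sameAtoms-just (mk⇔ (λ _ → refl) (λ _ → refl))
                                          (trans (irrefl G v) (≡.sym (irrefl H w)))

  sameAtoms-unassigned : ∀ v w → SameAtoms (just v) nothing (just w) nothing
  sameAtoms-unassigned _ _ = ⇔-id _ , ⇔-id _

  partialIso-update : ∀ {k} {ρ : Fin k → VG} {σ : Fin k → VH} {x v w} → PartialIso ρ σ →
    (∀ y → x ≢ y → SameAtoms (just v) (ρ y) (just w) (σ y)) →
    PartialIso (update ρ x (just v)) (update σ x (just w))
  partialIso-update {x = x} R new y z with x ≟ y | x ≟ z
  ... | yes _   | yes _   = sameAtoms-refl
  ... | yes _   | no x≢z  = new z x≢z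
  ... | no x≢y  | yes _   = sameAtoms-flip (new y x≢y)
  ... | no _    | no _    = R y z

  -- Assignedness is detected by the atom x ≐ x.
  data Aligned : VG → VH → Set where
    unassigned : Aligned nothing nothing
    assigned   : ∀ u w → Aligned (just u) (just w)

  aligned : ∀ {a b} → SameAtoms a a b b → Aligned a b
  aligned {nothing} {nothing} _       = unassigned
  aligned {just u}  {just w}  _       = assigned u w
  aligned {nothing} {just _}  (e , _) = ⊥-elim (from e refl)
  aligned {just _}  {nothing} (e , _) = ⊥-elim (to e refl)

forth⇒back : ∀ G H {k} → Forth H G k → Back G H k
forth⇒back G H F ρ σ R x w =
  map₂ (λ R′ y z → swap (R′ y z)) (F σ ρ (λ y z → swap (R y z)) x w)
  where
  swap : ∀ {X Y : Graph} {a a′ b b′} → SameAtoms X Y a a′ b b′ → SameAtoms Y X b b′ a a′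
  swap (e , d) = ⇔-sym e , ⇔-sym d

Equivalent : ℕ → Graph → Graph → Set
Equivalent k G H = (φ : Formula k) → G ⊨ φ ⇔ H ⊨ φ

equivalent-¬definable : ∀ {k G H} F → Equivalent k G H → F ⊏ G → ¬ F ⊏ H → ¬ DefinableWith k F
equivalent-¬definable {G = G} {H} F G≡H F⊏G F⋢H (φ , _ , defines) =
  F⋢H (proj₁ (defines H) (to (G≡H φ) (proj₂ (defines G) F⊏G)))

equivalent-¬distinguishable : ∀ {k G H} → Equivalent k G H → ¬ DistinguishableWith k G H
equivalent-¬distinguishable G≡H (φ , _ , inj₁ (G⊨φ , H⊭φ)) = H⊭φ (to (G≡H φ) G⊨φ)
equivalent-¬distinguishable G≡H (φ , _ , inj₂ (H⊨φ , G⊭φ)) = G⊭φ (from (G≡H φ) H⊨φ)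

definable-distinguishes : ∀ {k G H} F → DefinableWith k F → F ⊏ G → ¬ F ⊏ H →
                          DistinguishableWith k G H
definable-distinguishes {G = G} {H} F (φ , sentence , defines) F⊏G F⋢H =
  φ , sentence , inj₁ (proj₂ (defines G) F⊏G , λ H⊨φ → F⋢H (proj₁ (defines H) H⊨φ))

-- Triangle-free extendable graphs

TriangleFree : Graph → Set
TriangleFree X = ∀ u₁ u₂ v → (adj X u₁ u₂ ∧ adj X v u₁ ∧ adj X v u₂) ≡ false

OnePointExtension : Graph → Set
OnePointExtension X = ∀ b p → ∃[ w ] w ≢ b × adj X w b ≡ p

TwoPointExtension : Graph → Set
TwoPointExtension X = ∀ b₁ b₂ p q → b₁ ≢ b₂ → (adj X b₁ b₂ ∧ p ∧ q) ≡ false →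
  ∃[ w ] w ≢ b₁ × w ≢ b₂ × adj X w b₁ ≡ p × adj X w b₂ ≡ q

record Extendable (X : Graph) : Set where
  field
    vertex    : Fin (size X)
    one-point : OnePointExtension X
    two-point : TwoPointExtension X

-- With at most three variables, the variable being moved shares the board with at most two others.
otherVariables : ∀ {k} → k < 4 → (x : Fin k) → ∃₂ λ y₁ y₂ → ∀ y → x ≢ y → y ≡ y₁ ⊎ y ≡ y₂
otherVariables {1} _ 0F = 0F , 0F , λ { 0F 0≢0 → ⊥-elim (0≢0 refl) }
otherVariables {2} _ 0F = 1F , 1F , λ { 0F 0≢0 → ⊥-elim (0≢0 refl) ; 1F _ → inj₁ refl }
otherVariables {2} _ 1F = 0F , 0F , λ { 1F 1≢1 → ⊥-elim (1≢1 refl) ; 0F _ → inj₁ refl }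
otherVariables {3} _ 0F = 1F , 2F , λ { 0F 0≢0 → ⊥-elim (0≢0 refl) ; 1F _ → inj₁ refl ; 2F _ → inj₂ refl }
otherVariables {3} _ 1F = 0F , 2F , λ { 1F 1≢1 → ⊥-elim (1≢1 refl) ; 0F _ → inj₁ refl ; 2F _ → inj₂ refl }
otherVariables {3} _ 2F = 0F , 1F , λ { 2F 2≢2 → ⊥-elim (2≢2 refl) ; 0F _ → inj₁ refl ; 1F _ → inj₂ refl }
otherVariables {suc (suc (suc (suc _)))} (s≤s (s≤s (s≤s (s≤s ()))))

module _ {G H : Graph} (G-triangleFree : TriangleFree G) (H-extendable : Extendable H) where

  open Extendable H-extendable

  extend-one-point : ∀ u w v → ∃[ w′ ] SameAtoms G H (just v) (just u) (just w′) (just w)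
  extend-one-point u w v with v ≟ u
  ... | yes refl = w , sameAtoms-refl G H
  ... | no v≢u with one-point w (adj G v u)
  ... | w′ , w′≢w , e = w′ , sameAtoms-just G H (refuted-⇔ v≢u w′≢w) (≡.sym e)

  extend-two-points : ∀ u₁ u₂ w₁ w₂ → SameAtoms G H (just u₁) (just u₂) (just w₁) (just w₂) → ∀ v →
    ∃[ w ] SameAtoms G H (just v) (just u₁) (just w) (just w₁) ×
           SameAtoms G H (just v) (just u₂) (just w) (just w₂)
  extend-two-points u₁ u₂ w₁ w₂ s v with v ≟ u₁ | v ≟ u₂ | u₁ ≟ u₂
  ... | yes refl | _        | _ = w₁ , sameAtoms-refl G H , s
  ... | no _     | yes refl | _ = w₂ , sameAtoms-flip G H s , sameAtoms-refl G H
  ... | no _     | no _     | yes refl with to (proj₁ s) refl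
  ...   | refl = let (w , t) = extend-one-point u₁ w₁ v in w , t , t
  -- u₁ u₂ v is no triangle in G, so the pattern requested over w₁ w₂ creates none in H.
  extend-two-points u₁ u₂ w₁ w₂ s@(same-eq , same-adj) v | no v≢u₁ | no v≢u₂ | no u₁≢u₂
    with two-point w₁ w₂ (adj G v u₁) (adj G v u₂) (λ w₁≡w₂ → u₁≢u₂ (from same-eq w₁≡w₂))
           (subst (λ e → (e ∧ adj G v u₁ ∧ adj G v u₂) ≡ false) (⇔→≡ same-adj) (G-triangleFree u₁ u₂ v))
  ... | w , w≢w₁ , w≢w₂ , e₁ , e₂ =
    w , sameAtoms-just G H (refuted-⇔ v≢u₁ w≢w₁) (≡.sym e₁)
      , sameAtoms-just G H (refuted-⇔ v≢u₂ w≢w₂) (≡.sym e₂)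

  extend : ∀ {a₁ a₂ b₁ b₂} → Aligned G H a₁ b₁ → Aligned G H a₂ b₂ → SameAtoms G H a₁ a₂ b₁ b₂ → ∀ v →
    ∃[ w ] SameAtoms G H (just v) a₁ (just w) b₁ × SameAtoms G H (just v) a₂ (just w) b₂
  extend unassigned unassigned _ v = vertex , free , free
    where free = sameAtoms-unassigned G H v vertex
  extend unassigned (assigned u w) _ v =
    let (w′ , s) = extend-one-point u w v in w′ , sameAtoms-unassigned G H v w′ , s
  extend (assigned u w) unassigned _ v =
    let (w′ , s) = extend-one-point u w v in w′ , s , sameAtoms-unassigned G H v w′
  extend (assigned u₁ w₁) (assigned u₂ w₂) s v = extend-two-points u₁ u₂ w₁ w₂ s v

  forth : ∀ {k} → k < 4 → Forth G H k
  forth k<4 ρ σ R x v with otherVariables k<4 x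
  ... | y₁ , y₂ , others
    with extend (aligned G H (R y₁ y₁)) (aligned G H (R y₂ y₂)) (R y₁ y₂) v
  ... | w , s₁ , s₂ =
    w , partialIso-update G H R λ y x≢y → [ (λ { refl → s₁ }) , (λ { refl → s₂ }) ] (others y x≢y)

extendable-equivalent : ∀ {G H k} → TriangleFree G → Extendable G → TriangleFree H → Extendable H →
                        k < 4 → Equivalent k G H
extendable-equivalent {G} {H} G-tf G-ext H-tf H-ext k<4 =
  sat-⇔ G H (forth G-tf H-ext k<4) (forth⇒back G H (forth H-tf G-ext k<4)) (λ _ _ → ⇔-id _ , ⇔-id _)

-- Deciding properties of finite graphs

module _ (G : Graph) where

  adj? : (a b : Maybe (Fin (size G))) → Dec (Adj G a b)
  adj? (just u) (just v) = adj G u v ≟ᵇ true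
  adj? (just _) nothing  = no λ ()
  adj? nothing  _        = no λ ()

  eq? : (a b : Maybe (Fin (size G))) → Dec (Eq G a b)
  eq? (just u) (just v) = u ≟ v
  eq? (just _) nothing  = no λ ()
  eq? nothing  _        = no λ ()

  sat? : ∀ {k} ρ (φ : Formula k) → Dec (Sat G ρ φ)
  sat? ρ (x ∼ y)     = adj? (ρ x) (ρ y)
  sat? ρ (x ≐ y)     = eq? (ρ x) (ρ y)
  sat? ρ (¬' φ)      = ¬? (sat? ρ φ)
  sat? ρ (φ ∧' ψ)    = sat? ρ φ ×-dec sat? ρ ψ
  sat? ρ (φ ∨' ψ)    = sat? ρ φ ⊎-dec sat? ρ ψ
  sat? ρ (∃' x · φ)  = any? λ v → sat? (update ρ x (just v)) φ
  sat? ρ (∀' x · φ)  = all? λ v → sat? (update ρ x (just v)) φ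

  ⊨? : ∀ {k} (φ : Formula k) → Dec (G ⊨ φ)
  ⊨? = sat? (λ _ → nothing)

all-Bool? : {P : Bool → Set} → (∀ b → Dec (P b)) → Dec (∀ b → P b)
all-Bool? P? with P? true | P? false
... | yes t | yes f = yes λ { true → t ; false → f }
... | no ¬t | _     = no λ all → ¬t (all true)
... | yes _ | no ¬f = no λ all → ¬f (all false)

triangleFree? : ∀ X → Dec (TriangleFree X)
triangleFree? X = all? λ u₁ → all? λ u₂ → all? λ v → (adj X u₁ u₂ ∧ adj X v u₁ ∧ adj X v u₂) ≟ᵇ false

onePointExtension? : ∀ X → Dec (OnePointExtension X)
onePointExtension? X = all? λ b → all-Bool? λ p → any? λ w → ¬? (w ≟ b) ×-dec (adj X w b ≟ᵇ p)

twoPointExtension? : ∀ X → Dec (TwoPointExtension X)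
twoPointExtension? X =
  all? λ b₁ → all? λ b₂ → all-Bool? λ p → all-Bool? λ q →
  ¬? (b₁ ≟ b₂) →-dec (((adj X b₁ b₂ ∧ p ∧ q) ≟ᵇ false) →-dec
  any? λ w → ¬? (w ≟ b₁) ×-dec ¬? (w ≟ b₂) ×-dec (adj X w b₁ ≟ᵇ p) ×-dec (adj X w b₂ ≟ᵇ q))

-- The Wagner and Petersen graphs

adjacentIn : List (ℕ × ℕ) → ℕ → ℕ → Bool
adjacentIn []             u v = false
adjacentIn ((a , b) ∷ es) u v = (((u ≡ᵇ a) ∧ (v ≡ᵇ b)) ∨ ((u ≡ᵇ b) ∧ (v ≡ᵇ a))) ∨ adjacentIn es u v

adjacentIn-sym : ∀ es u v → adjacentIn es u v ≡ adjacentIn es v u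
adjacentIn-sym []             u v = refl
adjacentIn-sym ((a , b) ∷ es) u v = cong₂ _∨_
  (trans (∨-comm ((u ≡ᵇ a) ∧ (v ≡ᵇ b)) _) (cong₂ _∨_ (∧-comm (u ≡ᵇ b) _) (∧-comm (u ≡ᵇ a) _)))
  (adjacentIn-sym es u v)

edgeAdj : ∀ {n} → List (ℕ × ℕ) → Fin n → Fin n → Bool
edgeAdj es u v = adjacentIn es (toℕ u) (toℕ v)

loopless? : ∀ n es → Dec (∀ (v : Fin n) → edgeAdj es v v ≡ false)
loopless? n es = all? λ v → edgeAdj es v v ≟ᵇ false

edgeGraph : (n : ℕ) (es : List (ℕ × ℕ)) → {True (loopless? n es)} → Graph
edgeGraph n es {loopless} = record
  { size = n ; adj = edgeAdj es ; sym = λ u v → adjacentIn-sym es (toℕ u) (toℕ v)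
  ; irrefl = toWitness loopless }

-- Outer 5-cycle, spokes, inner pentagram.
Petersen : Graph
Petersen = edgeGraph 10 edges
  where
  edges : List (ℕ × ℕ)
  edges = (0 , 1) ∷ (1 , 2) ∷ (2 , 3) ∷ (3 , 4) ∷ (4 , 0)
        ∷ (0 , 5) ∷ (1 , 6) ∷ (2 , 7) ∷ (3 , 8) ∷ (4 , 9)
        ∷ (5 , 7) ∷ (7 , 9) ∷ (9 , 6) ∷ (6 , 8) ∷ (8 , 5) ∷ []

-- The 8-cycle with its four long diagonals.
Wagner : Graph
Wagner = edgeGraph 8 edges
  where
  edges : List (ℕ × ℕ)
  edges = (0 , 1) ∷ (1 , 2) ∷ (2 , 3) ∷ (3 , 4) ∷ (4 , 5) ∷ (5 , 6) ∷ (6 , 7) ∷ (7 , 0)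
        ∷ (0 , 4) ∷ (1 , 5) ∷ (2 , 6) ∷ (3 , 7) ∷ []

petersen-triangleFree : TriangleFree Petersen
petersen-triangleFree = from-yes (triangleFree? Petersen)

petersen-extendable : Extendable Petersen
petersen-extendable = record
  { vertex    = 0F
  ; one-point = from-yes (onePointExtension? Petersen)
  ; two-point = from-yes (twoPointExtension? Petersen) }

wagner-triangleFree : TriangleFree Wagner
wagner-triangleFree = from-yes (triangleFree? Wagner)

wagner-extendable : Extendable Wagner
wagner-extendable = record
  { vertex    = 0F
  ; one-point = from-yes (onePointExtension? Wagner)
  ; two-point = from-yes (twoPointExtension? Wagner) }

wagner≡₃petersen : ∀ {k} → k < 4 → Equivalent k Wagner Petersen
wagner≡₃petersen = extendable-equivalent wagner-triangleFree wagner-extendable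
                                         petersen-triangleFree petersen-extendable

-- The induced 4-cycle

-- Consecutive vertices need no disequality: adjacency already forces them apart.
inducedC4 : Formula 4
inducedC4 =
  (0F ∼ 1F) ∧' ((1F ∼ 2F) ∧' ((2F ∼ 3F) ∧' ((3F ∼ 0F) ∧'
  ((¬' (0F ∼ 2F)) ∧' ((¬' (1F ∼ 3F)) ∧' ((¬' (0F ≐ 2F)) ∧' (¬' (1F ≐ 3F))))))))

c4Sentence : Formula 4
c4Sentence = ∃' 0F · (∃' 1F · (∃' 2F · (∃' 3F · inducedC4)))

c4Sentence-closed : Sentence c4Sentence
c4Sentence-closed =
  (refl , refl) , (refl , refl) , (refl , refl) , (refl , refl) ,
  (refl , refl) , (refl , refl) , (refl , refl) , (refl , refl)

adjacent⇒≢ : ∀ G {u v} → adj G u v ≡ true → u ≢ v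
adjacent⇒≢ G {u} e refl with trans (≡.sym (irrefl G u)) e
... | ()

c4Sentence-sound : ∀ G → G ⊨ c4Sentence → C₄ ⊏ G
c4Sentence-sound G (v₀ , v₁ , v₂ , v₃ , a₀₁ , a₁₂ , a₂₃ , a₃₀ , n₀₂ , n₁₃ , d₀₂ , d₁₃) =
  f , injective , induced
  where
  f : Fin 4 → Fin (size G)
  f 0F = v₀
  f 1F = v₁
  f 2F = v₂
  f 3F = v₃

  injective : ∀ {u v} → f u ≡ f v → u ≡ v
  injective {0F} {0F} e = refl
  injective {0F} {1F} e = ⊥-elim (adjacent⇒≢ G a₀₁ e)
  injective {0F} {2F} e = ⊥-elim (d₀₂ e)
  injective {0F} {3F} e = ⊥-elim (adjacent⇒≢ G a₃₀ (≡.sym e))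
  injective {1F} {0F} e = ⊥-elim (adjacent⇒≢ G a₀₁ (≡.sym e))
  injective {1F} {1F} e = refl
  injective {1F} {2F} e = ⊥-elim (adjacent⇒≢ G a₁₂ e)
  injective {1F} {3F} e = ⊥-elim (d₁₃ e)
  injective {2F} {0F} e = ⊥-elim (d₀₂ (≡.sym e))
  injective {2F} {1F} e = ⊥-elim (adjacent⇒≢ G a₁₂ (≡.sym e))
  injective {2F} {2F} e = refl
  injective {2F} {3F} e = ⊥-elim (adjacent⇒≢ G a₂₃ e)
  injective {3F} {0F} e = ⊥-elim (adjacent⇒≢ G a₃₀ e)
  injective {3F} {1F} e = ⊥-elim (d₁₃ (≡.sym e))
  injective {3F} {2F} e = ⊥-elim (adjacent⇒≢ G a₂₃ (≡.sym e))
  injective {3F} {3F} e = refl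

  flipped : ∀ {u v} → adj G (f v) (f u) ≡ c4adj v u → adj G (f u) (f v) ≡ c4adj u v
  flipped {u} {v} e = trans (Graph.sym G (f u) (f v)) (trans e (c4sym v u))

  induced : ∀ u v → adj G (f u) (f v) ≡ c4adj u v
  induced 0F 0F = irrefl G v₀
  induced 0F 1F = a₀₁
  induced 0F 2F = ¬-not n₀₂
  induced 0F 3F = flipped {0F} {3F} a₃₀
  induced 1F 0F = flipped {1F} {0F} a₀₁
  induced 1F 1F = irrefl G v₁
  induced 1F 2F = a₁₂
  induced 1F 3F = ¬-not n₁₃
  induced 2F 0F = flipped {2F} {0F} (¬-not n₀₂)
  induced 2F 1F = flipped {2F} {1F} a₁₂
  induced 2F 2F = irrefl G v₂
  induced 2F 3F = a₂₃
  induced 3F 0F = a₃₀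
  induced 3F 1F = flipped {3F} {1F} (¬-not n₁₃)
  induced 3F 2F = flipped {3F} {2F} a₂₃
  induced 3F 3F = irrefl G v₃

c4Sentence-complete : ∀ G → C₄ ⊏ G → G ⊨ c4Sentence
c4Sentence-complete G (f , injective , induced) =
  f 0F , f 1F , f 2F , f 3F ,
  induced 0F 1F , induced 1F 2F , induced 2F 3F , induced 3F 0F ,
  not-¬ (induced 0F 2F) , not-¬ (induced 1F 3F) ,
  (λ e → case injective e of λ ()) , (λ e → case injective e of λ ())

C₄-definable : DefinableWith 4 C₄
C₄-definable = c4Sentence , c4Sentence-closed , λ G → c4Sentence-sound G , c4Sentence-complete G

C₄⊏Wagner : C₄ ⊏ Wagner
C₄⊏Wagner = c4Sentence-sound Wagner (from-yes (⊨? Wagner c4Sentence))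

C₄⋢Petersen : ¬ C₄ ⊏ Petersen
C₄⋢Petersen C₄⊏P = from-no (⊨? Petersen c4Sentence) (c4Sentence-complete Petersen C₄⊏P)

theorem4p10 : WEq C₄ 4 × WStarEq C₄ 4
theorem4p10 =
  ( C₄-definable
  , λ j j<4 → equivalent-¬definable C₄ (wagner≡₃petersen j<4) C₄⊏Wagner C₄⋢Petersen )
  , ( (λ G H → definable-distinguishes C₄ C₄-definable)
    , Wagner , Petersen , C₄⊏Wagner , C₄⋢Petersen
    , definable-distinguishes C₄ C₄-definable C₄⊏Wagner C₄⋢Petersen
    , λ j j<4 → equivalent-¬distinguishable (wagner≡₃petersen j<4) )
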